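{- For every integer $n\ge 2$, there exists a common subsequence of $\mathbf{t}_n$ and $\overline{\mathbf{t}}_n$ of length at least $n\left(1-\frac{1}{\lfloor\log_2(n)\rfloor/16}\right)$.
   Context: The Thue–Morse sequence $\mathbf{t}=t_0t_1t_2\cdots$ is the infinite binary sequence with $t_i$ equal to the parity of the number of $1$'s in the binary representation of $i$ (equivalently, the fixed point starting with $0$ of the morphism $0\mapsto 01$, $1\mapsto 10$). $\mathbf{t}_n$ is its prefix of length $n$, and $\overline{\mathbf{t}}_n$ is the bitwise complement of $\mathbf{t}_n$ (swap $0$ and $1$). A common subsequence of two words is a word that is a (not necessarily contiguous) subsequence of both. -}

module Defs where

open import Data.Bool using (Bool; not)
open import Data.Nat using (ℕ; zero; suc; _+_; _%_; _/_; _≡ᵇ_)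
open import Data.List using (List; map; upTo)

-- number of 1's in the binary representation of m, using fuel f
-- (fuel f ≥ number of binary digits of m suffices; we use fuel m)
popcount-aux : ℕ → ℕ → ℕ
popcount-aux zero    m = 0
popcount-aux (suc f) m = m % 2 + popcount-aux f (m / 2)

popcount : ℕ → ℕ
popcount m = popcount-aux m m

-- i-th letter of the Thue–Morse word: parity of the number of 1 bits of i
-- (false = 0, true = 1)
thueMorse : ℕ → Bool
thueMorse i = (popcount i % 2) ≡ᵇ 1

tPrefix : ℕ → List Bool
tPrefix n = map thueMorse (upTo n)

tbarPrefix : ℕ → List Bool
tbarPrefix n = map not (tPrefix n)

module Submission where

-- Write μ for the Thue–Morse morphism
-- (0 ↦ 01, 1 ↦ 10), so that t_{2^k M} = μ^k(t_M) and the blocks μ^k(0), μ^k(1) of length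
-- K = 2^k are complements of each other.
--
-- * Interleaving: if s is a common subsequence of two words X(0), X(1) of length K, then
--   the images of v and of its complement under b ↦ X(b) X(¬b) have a common subsequence
--   of length |v|(|s| + K) − |s|: shift one word by a block so that the blocks X(¬b) match
--   exactly and the remaining ones match through s.
-- * Iterating this along v = μ^(2i+1)(0) shows that the blocks of order m ≥ 2·2^i have a
--   common subsequence missing only D letters, with P²D + 2^m ≤ 2P·2^m for P = 2^i.
-- * For n ≥ 2^L, L = ⌊log₂ n⌋ ≥ 17, choose P ≈ L/8 and k ≥ 2P with 2P·2^(k+1) = 2^L, and
--   interleave the blocks of order k along t_M, M = ⌊n/2^(k+1)⌋; counting shows that at
--   most 16n/L letters of t_n are lost.  For L ≤ 16 the bound is vacuous.

open import Defs
open import Data.Bool using (Bool; true; false; not)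
open import Data.Nat
open import Data.Nat.Properties
open import Data.Nat.DivMod using (m*n%n≡0; m*n/n≡m; [m+kn]%n≡m%n; +-distrib-/-∣ʳ; m/n<m; m≡m%n+[m/n]*n; m%n<n)
open import Data.Nat.Divisibility using (n∣m*n)
open import Data.Nat.Induction using (<-rec)
open import Data.Nat.Logarithm using (⌊log₂_⌋; ⌊log₂⌋-mono-≤; ⌊log₂⌊n/2⌋⌋≡⌊log₂n⌋∸1)
open import Data.List using (List; []; _∷_; _++_; [_]; map; length; applyUpTo; upTo)
open import Data.List.Properties using (length-++; length-map; length-applyUpTo; map-upTo)
open import Data.List.Relation.Binary.Sublist.Propositional using (_⊆_; _∷_; ⊆-refl; ⊆-trans; minimum)
open import Data.List.Relation.Binary.Sublist.Propositional.Properties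
  using (++⁺; ++⁺ˡ; map⁺; length-mono-≤)
open import Data.Product using (Σ; _×_; _,_)
open import Relation.Nullary using (yes; no)
open import Relation.Binary.PropositionalEquality
  using (_≡_; refl; sym; trans; cong; cong₂; subst; subst₂; module ≡-Reasoning)
open import Data.Nat.Tactic.RingSolver using (solve-∀)

half≤ : ∀ {m f} → m ≤ suc f → m / 2 ≤ f
half≤ {zero}  _      = z≤n
half≤ {suc m} m≤1+f = ≤-pred (≤-trans (m/n<m (suc m) 2 (s≤s (s≤s z≤n))) m≤1+f)

popcount-aux-fuel : ∀ f g m → m ≤ f → m ≤ g → popcount-aux f m ≡ popcount-aux g m
popcount-aux-fuel zero    zero    m     _ _ = refl
popcount-aux-fuel zero    (suc g) .zero z≤n _ = popcount-aux-fuel zero g 0 z≤n z≤n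
popcount-aux-fuel (suc f) zero    .zero _ z≤n = popcount-aux-fuel f zero 0 z≤n z≤n
popcount-aux-fuel (suc f) (suc g) m m≤1+f m≤1+g =
  cong (m % 2 +_) (popcount-aux-fuel f g (m / 2) (half≤ m≤1+f) (half≤ m≤1+g))

popcount-unfold : ∀ m → popcount m ≡ m % 2 + popcount (m / 2)
popcount-unfold zero    = refl
popcount-unfold (suc m) =
  cong (suc m % 2 +_) (popcount-aux-fuel m (suc m / 2) (suc m / 2) (half≤ ≤-refl) ≤-refl)

popcount-double : ∀ i → popcount (i * 2) ≡ popcount i
popcount-double i = begin
  popcount (i * 2)                   ≡⟨ popcount-unfold (i * 2) ⟩
  (i * 2) % 2 + popcount (i * 2 / 2) ≡⟨ cong₂ _+_ (m*n%n≡0 i 2) (cong popcount (m*n/n≡m i 2)) ⟩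
  popcount i                         ∎
  where open ≡-Reasoning

popcount-double+1 : ∀ i → popcount (1 + i * 2) ≡ 1 + popcount i
popcount-double+1 i = begin
  popcount (1 + i * 2)                         ≡⟨ popcount-unfold (1 + i * 2) ⟩
  (1 + i * 2) % 2 + popcount ((1 + i * 2) / 2) ≡⟨ cong₂ _+_ ([m+kn]%n≡m%n 1 i 2) (cong popcount half) ⟩
  1 + popcount i                               ∎
  where
  open ≡-Reasoning
  half : (1 + i * 2) / 2 ≡ i
  half = trans (+-distrib-/-∣ʳ 1 {d = 2} (n∣m*n i)) (m*n/n≡m i 2)

parity-suc : ∀ p → (suc p % 2 ≡ᵇ 1) ≡ not (p % 2 ≡ᵇ 1)
parity-suc zero          = refl
parity-suc (suc zero)    = refl
parity-suc (suc (suc p)) = parity-suc p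

thueMorse-double : ∀ i → thueMorse (i * 2) ≡ thueMorse i
thueMorse-double i = cong (λ c → c % 2 ≡ᵇ 1) (popcount-double i)

thueMorse-double+1 : ∀ i → thueMorse (1 + i * 2) ≡ not (thueMorse i)
thueMorse-double+1 i = trans (cong (λ c → c % 2 ≡ᵇ 1) (popcount-double+1 i)) (parity-suc (popcount i))

μ : List Bool → List Bool
μ []      = []
μ (b ∷ u) = b ∷ not b ∷ μ u

μ^ : ℕ → List Bool → List Bool
μ^ zero    u = u
μ^ (suc k) u = μ^ k (μ u)

block : ℕ → Bool → List Bool
block k b = μ^ k [ b ]

μ^-+ : ∀ j k u → μ^ (j + k) u ≡ μ^ k (μ^ j u)
μ^-+ zero    k u = refl
μ^-+ (suc j) k u = μ^-+ j k (μ u)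

μ^-[] : ∀ k → μ^ k [] ≡ []
μ^-[] zero    = refl
μ^-[] (suc k) = μ^-[] k

μ-++ : ∀ u v → μ (u ++ v) ≡ μ u ++ μ v
μ-++ []      v = refl
μ-++ (b ∷ u) v = cong (λ w → b ∷ not b ∷ w) (μ-++ u v)

μ^-++ : ∀ k u v → μ^ k (u ++ v) ≡ μ^ k u ++ μ^ k v
μ^-++ zero    u v = refl
μ^-++ (suc k) u v = trans (cong (μ^ k) (μ-++ u v)) (μ^-++ k (μ u) (μ v))

μ-not : ∀ u → μ (map not u) ≡ map not (μ u)
μ-not []      = refl
μ-not (b ∷ u) = cong (λ w → not b ∷ not (not b) ∷ w) (μ-not u)

μ^-not : ∀ k u → μ^ k (map not u) ≡ map not (μ^ k u)
μ^-not zero    u = refl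
μ^-not (suc k) u = trans (cong (μ^ k) (μ-not u)) (μ^-not k (μ u))

length-μ : ∀ u → length (μ u) ≡ 2 * length u
length-μ []      = refl
length-μ (b ∷ u) = trans (cong (2 +_) (length-μ u)) (sym (*-distribˡ-+ 2 1 (length u)))

length-μ^ : ∀ k u → length (μ^ k u) ≡ 2 ^ k * length u
length-μ^ zero    u = sym (+-identityʳ (length u))
length-μ^ (suc k) u = begin
  length (μ^ k (μ u))    ≡⟨ length-μ^ k (μ u) ⟩
  2 ^ k * length (μ u)   ≡⟨ cong (2 ^ k *_) (length-μ u) ⟩
  2 ^ k * (2 * length u) ≡⟨ exchange (2 ^ k) (length u) ⟩
  2 ^ suc k * length u   ∎
  where
  open ≡-Reasoning
  exchange : ∀ a l → a * (2 * l) ≡ 2 * a * l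
  exchange = solve-∀

length-block : ∀ k b → length (block k b) ≡ 2 ^ k
length-block k b = trans (length-μ^ k [ b ]) (*-identityʳ (2 ^ k))

μ-applyUpTo : ∀ (x y : ℕ → Bool) M →
  (∀ i → y (i * 2) ≡ x i) → (∀ i → y (1 + i * 2) ≡ not (x i)) →
  μ (applyUpTo x M) ≡ applyUpTo y (M * 2)
μ-applyUpTo x y zero    even odd = refl
μ-applyUpTo x y (suc M) even odd =
  cong₂ _∷_ (sym (even 0)) (cong₂ _∷_ (sym (odd 0))
    (μ-applyUpTo (λ i → x (suc i)) (λ i → y (2 + i)) M (λ i → even (suc i)) (λ i → odd (suc i))))

tPrefix-applyUpTo : ∀ M → tPrefix M ≡ applyUpTo thueMorse M
tPrefix-applyUpTo = map-upTo thueMorse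

μ-tPrefix : ∀ M → μ (tPrefix M) ≡ tPrefix (M * 2)
μ-tPrefix M = begin
  μ (tPrefix M)                   ≡⟨ cong μ (tPrefix-applyUpTo M) ⟩
  μ (applyUpTo thueMorse M)       ≡⟨ μ-applyUpTo thueMorse thueMorse M thueMorse-double thueMorse-double+1 ⟩
  applyUpTo thueMorse (M * 2)     ≡⟨ sym (tPrefix-applyUpTo (M * 2)) ⟩
  tPrefix (M * 2)                 ∎
  where open ≡-Reasoning

μ^-tPrefix : ∀ k M → μ^ k (tPrefix M) ≡ tPrefix (M * 2 ^ k)
μ^-tPrefix zero    M = cong tPrefix (sym (*-identityʳ M))
μ^-tPrefix (suc k) M = begin
  μ^ k (μ (tPrefix M))    ≡⟨ cong (μ^ k) (μ-tPrefix M) ⟩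
  μ^ k (tPrefix (M * 2))  ≡⟨ μ^-tPrefix k (M * 2) ⟩
  tPrefix (M * 2 * 2 ^ k) ≡⟨ cong tPrefix (*-assoc M 2 (2 ^ k)) ⟩
  tPrefix (M * 2 ^ suc k) ∎
  where open ≡-Reasoning

applyUpTo-⊆ : ∀ {A : Set} (x : ℕ → A) {a b} → a ≤ b → applyUpTo x a ⊆ applyUpTo x b
applyUpTo-⊆ x {zero}  {b}     _         = minimum (applyUpTo x b)
applyUpTo-⊆ x {suc a} {suc b} (s≤s a≤b) = refl ∷ applyUpTo-⊆ (λ i → x (suc i)) a≤b

tPrefix-⊆ : ∀ {a b} → a ≤ b → tPrefix a ⊆ tPrefix b
tPrefix-⊆ {a} {b} a≤b =
  subst₂ _⊆_ (sym (tPrefix-applyUpTo a)) (sym (tPrefix-applyUpTo b)) (applyUpTo-⊆ thueMorse a≤b)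

blocks : (Bool → List Bool) → List Bool → List Bool
blocks X []      = []
blocks X (b ∷ v) = X b ++ X (not b) ++ blocks X v

μ^-μ-blocks : ∀ k v → μ^ k (μ v) ≡ blocks (block k) v
μ^-μ-blocks k []      = μ^-[] k
μ^-μ-blocks k (b ∷ v) = begin
  μ^ k ([ b ] ++ [ not b ] ++ μ v)                    ≡⟨ μ^-++ k [ b ] _ ⟩
  block k b ++ μ^ k ([ not b ] ++ μ v)                ≡⟨ cong (block k b ++_) (μ^-++ k [ not b ] (μ v)) ⟩
  block k b ++ block k (not b) ++ μ^ k (μ v)          ≡⟨ cong (λ w → block k b ++ block k (not b) ++ w) (μ^-μ-blocks k v) ⟩
  block k b ++ block k (not b) ++ blocks (block k) v  ∎
  where open ≡-Reasoning

-- In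
-- blocks X v and blocks X (¬v) the blocks X(¬b) coincide; shifting the second word by
-- one block aligns them, and the remaining blocks X(b), X(b') are matched through s.
-- Each letter of v then contributes ℓ + K letters, and only one copy of s is lost.
module Interleave (X : Bool → List Bool) (K : ℕ) (length-X : ∀ b → length (X b) ≡ K)
                  (s : List Bool) (s⊆X : ∀ b → s ⊆ X b) where

  ℓ : ℕ
  ℓ = length s

  -- The shifted alignment: the second word is preceded by an arbitrary block X(c).
  shifted : ∀ c v → Σ (List Bool) λ w →
    w ⊆ blocks X v × w ⊆ X c ++ blocks X (map not v) × length w ≡ length v * (ℓ + K)
  shifted c []      = [] , minimum _ , minimum _ , refl
  shifted c (b ∷ v) with shifted (not (not b)) v
  ... | w , w⊆v , w⊆¬v , |w| =
    s ++ X (not b) ++ w , ++⁺ (s⊆X b) (++⁺ ⊆-refl w⊆v) , ++⁺ (s⊆X c) (++⁺ ⊆-refl w⊆¬v) , length-w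
    where
    open ≡-Reasoning
    length-w : length (s ++ X (not b) ++ w) ≡ suc (length v) * (ℓ + K)
    length-w = begin
      length (s ++ X (not b) ++ w)        ≡⟨ length-++ s ⟩
      ℓ + length (X (not b) ++ w)         ≡⟨ cong (ℓ +_) (length-++ (X (not b))) ⟩
      ℓ + (length (X (not b)) + length w) ≡⟨ cong₂ (λ x y → ℓ + (x + y)) (length-X (not b)) |w| ⟩
      ℓ + (K + length v * (ℓ + K))        ≡⟨ sym (+-assoc ℓ K _) ⟩
      suc (length v) * (ℓ + K)            ∎

  -- Dropping the first block of blocks X v yields the shifted alignment.
  interleave : ∀ v → Σ (List Bool) λ w →
    w ⊆ blocks X v × w ⊆ blocks X (map not v) × length v * (ℓ + K) ≤ length w + ℓ
  interleave []      = [] , minimum _ , minimum _ , z≤n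
  interleave (b ∷ v) with shifted (not (not b)) v
  ... | w , w⊆v , w⊆¬v , |w| =
    X (not b) ++ w , ++⁺ˡ (X b) (++⁺ ⊆-refl w⊆v) , ++⁺ ⊆-refl w⊆¬v , ≤-reflexive length-w
    where
    open ≡-Reasoning
    length-w : suc (length v) * (ℓ + K) ≡ length (X (not b) ++ w) + ℓ
    length-w = begin
      suc (length v) * (ℓ + K)            ≡⟨ rearrange ℓ K (length v * (ℓ + K)) ⟩
      (K + length v * (ℓ + K)) + ℓ        ≡⟨ cong₂ (λ x y → (x + y) + ℓ) (sym (length-X (not b))) (sym |w|) ⟩
      (length (X (not b)) + length w) + ℓ ≡⟨ cong (_+ ℓ) (sym (length-++ (X (not b)))) ⟩
      length (X (not b) ++ w) + ℓ         ∎
      where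
      rearrange : ∀ a b c → (a + b) + c ≡ (b + c) + a
      rearrange = solve-∀

block-+ : ∀ j k b → block (j + suc k) b ≡ blocks (block k) (block j b)
block-+ j k b = trans (μ^-+ j (suc k) [ b ]) (μ^-μ-blocks k (block j b))

block-not : ∀ j b → block j (not b) ≡ map not (block j b)
block-not j b = μ^-not j [ b ]

CommonUpTo : ℕ → ℕ → Set
CommonUpTo m D = Σ (List Bool) λ s → (∀ b → s ⊆ block m b) × 2 ^ m ≤ length s + D

DeficiencyBound : ℕ → ℕ → ℕ → Set
DeficiencyBound P K D = P * P * D + K ≤ 2 * P * K

2^[1+i+i] : ∀ i → 2 ^ suc (i + i) ≡ 2 * 2 ^ i * 2 ^ i
2^[1+i+i] i = trans (cong (2 *_) (^-distribˡ-+-* 2 i i)) (sym (*-assoc 2 (2 ^ i) (2 ^ i)))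

-- Counting: 2Q·K letters, Q blocks lose K − ℓ ≤ D letters each, plus one copy of s.
deficiency-length : ∀ Q K ℓ D lw → Q * (ℓ + K) ≤ lw + ℓ → K ≤ ℓ + D → Q * (2 * K) ≤ lw + (ℓ + Q * D)
deficiency-length Q K ℓ D lw hw K≤ℓ+D = begin
  Q * (2 * K)             ≡⟨ e₁ Q K ⟩
  Q * K + Q * K           ≤⟨ +-monoʳ-≤ (Q * K) (*-monoʳ-≤ Q K≤ℓ+D) ⟩
  Q * K + Q * (ℓ + D)     ≡⟨ e₂ Q K ℓ D ⟩
  Q * (ℓ + K) + Q * D     ≤⟨ +-monoˡ-≤ (Q * D) hw ⟩
  lw + ℓ + Q * D          ≡⟨ +-assoc lw ℓ (Q * D) ⟩
  lw + (ℓ + Q * D)        ∎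
  where
  open ≤-Reasoning
  e₁ : ∀ Q K → Q * (2 * K) ≡ Q * K + Q * K
  e₁ = solve-∀
  e₂ : ∀ Q K ℓ D → Q * K + Q * (ℓ + D) ≡ Q * (ℓ + K) + Q * D
  e₂ = solve-∀

deficiency-bound-step : ∀ P K ℓ D → ℓ ≤ K → DeficiencyBound P K D →
  DeficiencyBound (2 * P) (2 * P * P * (2 * K)) (ℓ + 2 * P * P * D)
deficiency-bound-step P K ℓ D ℓ≤K bound = begin
  2 * P * (2 * P) * (ℓ + 2 * P * P * D) + 2 * P * P * (2 * K)
    ≡⟨ e₁ P K ℓ D ⟩
  4 * P * P * ℓ + (4 * P * P * K + 8 * P * P * (P * P * D))
    ≤⟨ +-monoˡ-≤ _ (*-monoʳ-≤ (4 * P * P) ℓ≤K) ⟩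
  4 * P * P * K + (4 * P * P * K + 8 * P * P * (P * P * D))
    ≡⟨ e₂ P K D ⟩
  8 * P * P * (P * P * D + K)
    ≤⟨ *-monoʳ-≤ (8 * P * P) bound ⟩
  8 * P * P * (2 * P * K)
    ≡⟨ e₃ P K ⟩
  2 * (2 * P) * (2 * P * P * (2 * K)) ∎
  where
  open ≤-Reasoning
  e₁ : ∀ P K ℓ D → 2 * P * (2 * P) * (ℓ + 2 * P * P * D) + 2 * P * P * (2 * K)
                 ≡ 4 * P * P * ℓ + (4 * P * P * K + 8 * P * P * (P * P * D))
  e₁ = solve-∀
  e₂ : ∀ P K D → 4 * P * P * K + (4 * P * P * K + 8 * P * P * (P * P * D)) ≡ 8 * P * P * (P * P * D + K)
  e₂ = solve-∀
  e₃ : ∀ P K → 8 * P * P * (2 * P * K) ≡ 2 * (2 * P) * (2 * P * P * (2 * K))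
  e₃ = solve-∀

-- The inductive step: interleaving the blocks of order k along v = block (2i+1) 0 gives
-- a common subsequence of the blocks of order (2i+1) + (k+1) at the doubled scale.
deficiency-step : ∀ i k D → CommonUpTo k D → DeficiencyBound (2 ^ i) (2 ^ k) D →
  Σ ℕ λ D′ → CommonUpTo (suc (i + i) + suc k) D′ × DeficiencyBound (2 ^ suc i) (2 ^ (suc (i + i) + suc k)) D′
deficiency-step i k D (s , s⊆X , K≤ℓ+D) bound
  with Interleave.interleave (block k) (2 ^ k) (length-block k) s s⊆X (block (suc (i + i)) false)
... | w , w⊆v , w⊆¬v , hw =
  ℓ + Q * D , (w , w⊆X , length-w) , subst (λ K′ → DeficiencyBound (2 * P) K′ (ℓ + Q * D)) (sym 2^m) bound′
  where
  j = suc (i + i)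
  P = 2 ^ i
  K = 2 ^ k
  Q = 2 * P * P
  ℓ = length s
  2^m : 2 ^ (j + suc k) ≡ Q * (2 * K)
  2^m = trans (^-distribˡ-+-* 2 j (suc k)) (cong (_* (2 * K)) (2^[1+i+i] i))
  w⊆X : ∀ b → w ⊆ block (j + suc k) b
  w⊆X false = subst (w ⊆_) (sym (block-+ j k false)) w⊆v
  w⊆X true  = subst (w ⊆_) (sym (trans (block-+ j k true) (cong (blocks (block k)) (block-not j false)))) w⊆¬v
  length-w : 2 ^ (j + suc k) ≤ length w + (ℓ + Q * D)
  length-w = subst (_≤ length w + (ℓ + Q * D)) (sym 2^m)
    (deficiency-length Q K ℓ D (length w)
      (subst (λ x → x * (ℓ + K) ≤ length w + ℓ) (trans (length-block j false) (2^[1+i+i] i)) hw) K≤ℓ+D)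
  bound′ : DeficiencyBound (2 * P) (Q * (2 * K)) (ℓ + Q * D)
  bound′ = deficiency-bound-step P K ℓ D (subst (ℓ ≤_) (length-block k false) (length-mono-≤ (s⊆X false))) bound

pow-bound : ∀ i → suc (suc (i + i)) ≤ 2 * 2 ^ i
pow-bound zero    = ≤-refl
pow-bound (suc i) = begin
  suc (suc (suc (i + suc i))) ≡⟨ cong (λ x → suc (suc (suc x))) (+-suc i i) ⟩
  2 + (2 + (i + i))           ≤⟨ +-mono-≤ (*-monoʳ-≤ 2 (m^n>0 2 i)) (pow-bound i) ⟩
  2 * 2 ^ i + 2 * 2 ^ i       ≡⟨ double (2 ^ i) ⟩
  2 * 2 ^ suc i               ∎
  where
  open ≤-Reasoning
  double : ∀ P → 2 * P + 2 * P ≡ 2 * (2 * P)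
  double = solve-∀

split-exponent : ∀ {a P m} → suc a ≤ 2 * P → 2 * (2 * P) ≤ m → Σ ℕ λ k → 2 * P ≤ k × a + suc k ≡ m
split-exponent {a} {P} {m} a<2P 4P≤m with m≤n⇒∃[o]m+o≡n (≤-trans (+-monoˡ-≤ (2 * P) a<2P) 4P≤m′)
  where
  4P≤m′ : 2 * P + 2 * P ≤ m
  4P≤m′ = subst (_≤ m) (double P) 4P≤m
    where
    double : ∀ P → 2 * (2 * P) ≡ 2 * P + 2 * P
    double = solve-∀
... | o , eq = 2 * P + o , m≤m+n (2 * P) o , trans (+-suc a (2 * P + o)) (trans (sym (+-assoc (suc a) (2 * P) o)) eq)

block-deficiency : ∀ i m → 2 * 2 ^ i ≤ m → Σ ℕ λ D → CommonUpTo m D × DeficiencyBound (2 ^ i) (2 ^ m) D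
block-deficiency zero    m _ = 2 ^ m , ([] , (λ b → minimum (block m b)) , ≤-refl) , ≤-reflexive (one (2 ^ m))
  where
  one : ∀ K → 1 * 1 * K + K ≡ 2 * 1 * K
  one = solve-∀
block-deficiency (suc i) m 4P≤m with split-exponent {P = 2 ^ i} (pow-bound i) 4P≤m
... | k , 2P≤k , refl with block-deficiency i k 2P≤k
... | D , common , bound = deficiency-step i k D common bound

prefix-common : ∀ k s → (∀ b → s ⊆ block k b) → ∀ M → Σ (List Bool) λ w →
  w ⊆ tPrefix (M * 2 ^ suc k) × w ⊆ tbarPrefix (M * 2 ^ suc k) × M * (length s + 2 ^ k) ≤ length w + length s
prefix-common k s s⊆X M with Interleave.interleave (block k) (2 ^ k) (length-block k) s s⊆X (tPrefix M)
... | w , w⊆t , w⊆t̄ , hw =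
  w , subst (w ⊆_) t≡ w⊆t , subst (w ⊆_) t̄≡ w⊆t̄ ,
  subst (λ x → x * (length s + 2 ^ k) ≤ length w + length s) (length-tPrefix M) hw
  where
  open ≡-Reasoning
  length-tPrefix : ∀ M → length (tPrefix M) ≡ M
  length-tPrefix M = trans (length-map thueMorse (upTo M)) (length-applyUpTo (λ i → i) M)
  t≡ : blocks (block k) (tPrefix M) ≡ tPrefix (M * 2 ^ suc k)
  t≡ = trans (sym (μ^-μ-blocks k (tPrefix M))) (μ^-tPrefix (suc k) M)
  t̄≡ : blocks (block k) (map not (tPrefix M)) ≡ tbarPrefix (M * 2 ^ suc k)
  t̄≡ = begin
    blocks (block k) (map not (tPrefix M)) ≡⟨ sym (μ^-μ-blocks k (map not (tPrefix M))) ⟩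
    μ^ (suc k) (map not (tPrefix M))       ≡⟨ μ^-not (suc k) (tPrefix M) ⟩
    map not (μ^ (suc k) (tPrefix M))       ≡⟨ cong (map not) (μ^-tPrefix (suc k) M) ⟩
    tbarPrefix (M * 2 ^ suc k)             ∎

deficiency-bound-weak : ∀ P K D → 1 ≤ P → DeficiencyBound P K D → P * D ≤ 2 * K
deficiency-bound-weak P K D 1≤P bound = *-cancelˡ-≤ P (begin
  P * (P * D)   ≡⟨ sym (*-assoc P P D) ⟩
  P * P * D     ≤⟨ m+n≤o⇒m≤o (P * P * D) bound ⟩
  2 * P * K     ≡⟨ e P K ⟩
  P * (2 * K)   ∎)
  where
  open ≤-Reasoning
  instance _ = >-nonZero 1≤P
  e : ∀ P K → 2 * P * K ≡ P * (2 * K)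
  e = solve-∀

missing-bound : ∀ n L P K ℓ r M D → ℓ ≤ K → r < 2 * K → P * D ≤ 2 * K → L ≤ 2 * (2 * (2 * P)) →
  2 * P * (2 * K) ≤ n → M * (2 * K) ≤ n → (ℓ + r + M * D) * L ≤ 16 * n
missing-bound n L P K ℓ r M D ℓ≤K r<2K PD≤2K L≤8P 4PK≤n 2MK≤n = begin
  (ℓ + r + M * D) * L
    ≤⟨ *-monoʳ-≤ (ℓ + r + M * D) L≤8P ⟩
  (ℓ + r + M * D) * (2 * (2 * (2 * P)))
    ≡⟨ e₁ ℓ r M D P ⟩
  8 * P * ℓ + 8 * P * r + 8 * M * (P * D)
    ≤⟨ +-mono-≤ (+-mono-≤ (*-monoʳ-≤ (8 * P) ℓ≤K) (*-monoʳ-≤ (8 * P) (<⇒≤ r<2K))) (*-monoʳ-≤ (8 * M) PD≤2K) ⟩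
  8 * P * K + 8 * P * (2 * K) + 8 * M * (2 * K)
    ≡⟨ e₂ P K M ⟩
  6 * (2 * P * (2 * K)) + 8 * (M * (2 * K))
    ≤⟨ +-mono-≤ (*-monoʳ-≤ 6 4PK≤n) (*-monoʳ-≤ 8 2MK≤n) ⟩
  6 * n + 8 * n
    ≡⟨ sym (*-distribʳ-+ n 6 8) ⟩
  14 * n
    ≤⟨ *-monoˡ-≤ n (m≤n+m 14 2) ⟩
  16 * n ∎
  where
  open ≤-Reasoning
  e₁ : ∀ ℓ r M D P → (ℓ + r + M * D) * (2 * (2 * (2 * P))) ≡ 8 * P * ℓ + 8 * P * r + 8 * M * (P * D)
  e₁ = solve-∀
  e₂ : ∀ P K M → 8 * P * K + 8 * P * (2 * K) + 8 * M * (2 * K) ≡ 6 * (2 * P * (2 * K)) + 8 * (M * (2 * K))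
  e₂ = solve-∀

2^⌊log₂⌋≤ : ∀ n → 1 ≤ n → 2 ^ ⌊log₂ n ⌋ ≤ n
2^⌊log₂⌋≤ = <-rec (λ n → 1 ≤ n → 2 ^ ⌊log₂ n ⌋ ≤ n) step
  where
  step : ∀ n → (∀ {m} → m < n → 1 ≤ m → 2 ^ ⌊log₂ m ⌋ ≤ m) → 1 ≤ n → 2 ^ ⌊log₂ n ⌋ ≤ n
  step (suc zero)    _   _ = ≤-refl
  step (suc (suc n)) rec _ = begin
    2 ^ ⌊log₂ m ⌋                 ≡⟨ cong (2 ^_) (sym log-halve) ⟩
    2 * 2 ^ ⌊log₂ ⌊ m /2⌋ ⌋       ≤⟨ *-monoʳ-≤ 2 (rec (⌊n/2⌋<n (suc n)) (s≤s z≤n)) ⟩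
    ⌊ m /2⌋ + (⌊ m /2⌋ + 0)       ≤⟨ +-monoʳ-≤ ⌊ m /2⌋ (subst (_≤ ⌈ m /2⌉) (sym (+-identityʳ _)) (⌊n/2⌋≤⌈n/2⌉ m)) ⟩
    ⌊ m /2⌋ + ⌈ m /2⌉             ≡⟨ ⌊n/2⌋+⌈n/2⌉≡n m ⟩
    m                             ∎
    where
    open ≤-Reasoning
    m = suc (suc n)
    1≤log : 1 ≤ ⌊log₂ m ⌋
    1≤log = ⌊log₂⌋-mono-≤ {2} {m} (s≤s (s≤s z≤n))
    log-halve : suc ⌊log₂ ⌊ m /2⌋ ⌋ ≡ ⌊log₂ m ⌋
    log-halve = trans (cong suc (⌊log₂⌊n/2⌋⌋≡⌊log₂n⌋∸1 m)) (trans (+-comm 1 _) (m∸n+n≡m 1≤log))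

dyadic-scale : ∀ L → 2 ^ 2 ≤ L → Σ ℕ λ i → 2 ^ (2 + i) ≤ L × L < 2 ^ (3 + i)
dyadic-scale L 4≤L = search L (≤-trans L<2^[1+L] (^-monoʳ-≤ 2 (m≤n+m (suc L) 2)))
  where
  L<2^[1+L] : L < 2 ^ suc L
  L<2^[1+L] = ≤-trans (m≤n⇒m≤1+n (s≤s (m≤m+n L L))) (pow-bound L)
  search : ∀ t → L < 2 ^ (3 + t) → Σ ℕ λ i → 2 ^ (2 + i) ≤ L × L < 2 ^ (3 + i)
  search zero    L<8 = 0 , 4≤L , L<8
  search (suc t) L<2^[4+t] with L <? 2 ^ (3 + t)
  ... | yes L<2^[3+t] = search t L<2^[3+t]
  ... | no  L≮2^[3+t] = suc t , ≮⇒≥ L≮2^[3+t] , L<2^[4+t]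

euclid : ∀ n d → 1 ≤ d → Σ ℕ λ M → Σ ℕ λ r → n ≡ r + M * d × r < d
euclid n (suc d) _ = n / suc d , n % suc d , m≡m%n+[m/n]*n n (suc d) , m%n<n n (suc d)

-- For L ≥ 17 and n ≥ 2^L: choose 2^(i+2) ≤ L < 2^(i+3), write L = (i+1) + (k+1) with
-- k ≥ 2^(i+1), take blocks of order k with deficiency D ≤ 2K/P, cut n into M pieces of
-- length 2K (remainder r) and interleave along t_M. At most ℓ + r + M·D ≤ 16n/L letters are lost.
long-common-subsequence : ∀ n L → 17 ≤ L → 2 ^ L ≤ n →
  Σ (List Bool) λ w → w ⊆ tPrefix n × w ⊆ tbarPrefix n × n * L ≤ length w * L + 16 * n
long-common-subsequence n L 17≤L 2^L≤n with dyadic-scale L (≤-trans (m≤n+m 4 13) 17≤L)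
... | i , 4P≤L , L<8P with split-exponent {a = suc i} {P = 2 ^ i} (≤-trans (s≤s (s≤s (m≤m+n i i))) (pow-bound i)) 4P≤L
... | k , 2P≤k , refl with block-deficiency i k 2P≤k
... | D , (s , s⊆X , K≤ℓ+D) , bound with euclid n (2 ^ suc k) (m^n>0 2 (suc k))
... | M , r , n≡ , r<2K with prefix-common k s s⊆X M
... | w , w⊆t , w⊆t̄ , hw =
  w , ⊆-trans w⊆t (tPrefix-⊆ 2MK≤n) , ⊆-trans w⊆t̄ (map⁺ not (tPrefix-⊆ 2MK≤n)) , count
  where
  open ≤-Reasoning
  P = 2 ^ i
  K = 2 ^ k
  ℓ = length s
  lw = length w
  missing = ℓ + r + M * D
  2MK≤n : M * (2 * K) ≤ n
  2MK≤n = subst (M * (2 * K) ≤_) (sym n≡) (m≤n+m (M * (2 * K)) r)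
  4PK≤n : 2 * P * (2 * K) ≤ n
  4PK≤n = subst (_≤ n) (^-distribˡ-+-* 2 (suc i) (suc k)) 2^L≤n
  ℓ≤K : ℓ ≤ K
  ℓ≤K = subst (ℓ ≤_) (length-block k false) (length-mono-≤ (s⊆X false))
  n≤ : n ≤ lw + missing
  n≤ = begin
    n                           ≡⟨ n≡ ⟩
    r + M * (2 * K)             ≤⟨ +-monoʳ-≤ r (deficiency-length M K ℓ D lw hw K≤ℓ+D) ⟩
    r + (lw + (ℓ + M * D))      ≡⟨ e r lw ℓ (M * D) ⟩
    lw + missing                ∎
    where
    e : ∀ r lw ℓ x → r + (lw + (ℓ + x)) ≡ lw + (ℓ + r + x)
    e = solve-∀
  count : n * (suc i + suc k) ≤ lw * (suc i + suc k) + 16 * n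
  count = begin
    n * (suc i + suc k)                                  ≤⟨ *-monoˡ-≤ (suc i + suc k) n≤ ⟩
    (lw + missing) * (suc i + suc k)                     ≡⟨ *-distribʳ-+ (suc i + suc k) lw missing ⟩
    lw * (suc i + suc k) + missing * (suc i + suc k)     ≤⟨ +-monoʳ-≤ (lw * (suc i + suc k))
      (missing-bound n (suc i + suc k) P K ℓ r M D ℓ≤K r<2K
        (deficiency-bound-weak P K D (m^n>0 2 i) bound) (<⇒≤ L<8P) 4PK≤n 2MK≤n) ⟩
    lw * (suc i + suc k) + 16 * n                        ∎

theorem3 : (n : ℕ) → 2 ≤ n →
    Σ (List Bool) (λ w → (w ⊆ tPrefix n) × (w ⊆ tbarPrefix n) ×
      (n * ⌊log₂ n ⌋ ≤ length w * ⌊log₂ n ⌋ + 16 * n))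
theorem3 n 2≤n with ⌊log₂ n ⌋ ≤? 16
... | yes log≤16 = [] , minimum _ , minimum _ , ≤-trans (*-monoʳ-≤ n log≤16) (≤-reflexive (*-comm n 16))
... | no  log≰16 = long-common-subsequence n ⌊log₂ n ⌋ (≰⇒> log≰16) (2^⌊log₂⌋≤ n (≤-trans (s≤s z≤n) 2≤n))
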